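{- Let $m\geq 1$ and $n\geq 2$ be integers and let $G=E_n+K_m$. Then $$\alpha(F_2(G))=\begin{cases}\left\lceil\frac{m+2}{2}\right\rceil & \text{if } n=2,\\[2pt] \left\lfloor\frac{m}{2}\right\rfloor+\binom{n}{2} & \text{if } n\geq 3.\end{cases}$$
   Context: $E_n$ is the edgeless graph on $n$ vertices and $K_m$ the complete graph on $m$ vertices. The join $G_1+G_2$ of disjoint graphs has vertex set $V(G_1)\cup V(G_2)$ and edge set $E(G_1)\cup E(G_2)\cup\{uv: u\in V(G_1), v\in V(G_2)\}$. For a finite simple graph $G$, the $2$-token graph $F_2(G)$ has as vertices the $2$-element subsets of $V(G)$, two adjacent iff their symmetric difference is an edge of $G$. $\alpha$ is the independence number. -}

module Defs where

open import Data.Nat using (ℕ; _≤_; _+_)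
open import Data.Fin using (Fin; toℕ)
open import Data.Fin.Subset using (Subset; _∈_; ∣_∣)
open import Data.List using (List; length)
open import Data.List.Relation.Unary.AllPairs using (AllPairs)
open import Data.Product using (Σ; ∃₂; _×_; _,_; proj₁)
open import Data.Sum using (_⊎_; inj₁; inj₂)
open import Function.Bundles using (_⇔_; mk⇔; Equivalence)
open import Relation.Binary.PropositionalEquality using (_≡_; _≢_; refl; sym)
open import Relation.Nullary using (¬_)

record Graph (V : Set) : Set₁ where
  field
    Adj  : V → V → Set
    adj-sym : ∀ {u v} → Adj u v → Adj v u
    adj-irr : ∀ {u} → ¬ Adj u u
open Graph public

-- G = E_n + K_m with vertex set Fin (n + m):
-- vertices with index < n form E_n, those with index ≥ n form K_m.
-- Two distinct vertices are adjacent unless both lie in E_n.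
JoinAdj : (n m : ℕ) → Fin (n + m) → Fin (n + m) → Set
JoinAdj n m u v = u ≢ v × (n ≤ toℕ u ⊎ n ≤ toℕ v)

EK : (n m : ℕ) → Graph (Fin (n + m))
EK n m = record
  { Adj = JoinAdj n m
  ; adj-sym = λ { (u≢v , inj₁ p) → (λ e → u≢v (sym e)) , inj₂ p
                ; (u≢v , inj₂ p) → (λ e → u≢v (sym e)) , inj₁ p }
  ; adj-irr = λ { (u≢u , _) → u≢u refl }
  }

_∈Δ_,_ : ∀ {N} → Fin N → Subset N → Subset N → Set
z ∈Δ A , B = (z ∈ A × ¬ z ∈ B) ⊎ (z ∈ B × ¬ z ∈ A)

TwoSet : ℕ → Set
TwoSet N = Σ (Subset N) (λ A → ∣ A ∣ ≡ 2)

F2Adj : ∀ {N} → (Fin N → Fin N → Set) → TwoSet N → TwoSet N → Set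
F2Adj {N} adj (A , _) (B , _) =
  ∃₂ λ (x y : Fin N) → adj x y × (∀ z → (z ∈Δ A , B) ⇔ (z ≡ x ⊎ z ≡ y))

IsIndependent : ∀ {V} → Graph V → List V → Set
IsIndependent H xs = AllPairs (λ u v → u ≢ v × ¬ Adj H u v) xs

IndependenceNumber : ∀ {V} → Graph V → ℕ → Set
IndependenceNumber H k =
  (Σ (List _) λ xs → IsIndependent H xs × length xs ≡ k) ×
  (∀ xs → IsIndependent H xs → length xs ≤ k)

Δ-sym : ∀ {N} {z : Fin N} {A B} → z ∈Δ A , B → z ∈Δ B , A
Δ-sym (inj₁ p) = inj₂ p
Δ-sym (inj₂ p) = inj₁ p

⊎-swap : ∀ {N} {z x y : Fin N} → (z ≡ x ⊎ z ≡ y) → (z ≡ y ⊎ z ≡ x)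
⊎-swap (inj₁ p) = inj₂ p
⊎-swap (inj₂ p) = inj₁ p

F2 : ∀ {N} → Graph (Fin N) → Graph (TwoSet N)
F2 {N} G = record
  { Adj = F2Adj (Adj G)
  ; adj-sym = λ { (x , y , e , h) → y , x , adj-sym G e ,
        λ z → mk⇔ (λ p → ⊎-swap (Equivalence.to (h z) (Δ-sym p)))
                  (λ q → Δ-sym (Equivalence.from (h z) (⊎-swap q))) }
  ; adj-irr = λ { (x , y , e , h) → noΔ (Equivalence.from (h x) (inj₁ refl)) }
  }
  where
    noΔ : ∀ {z : Fin N} {A} → ¬ (z ∈Δ A , A)
    noΔ (inj₁ (p , q)) = q p
    noΔ (inj₂ (p , q)) = q p

{-# OPTIONS --safe #-}
-- Write E for the vertices of E_n and K for those of K_m. Two 2-sets sharing a vertex are adjacent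
-- in F₂(G) as soon as their other vertices differ and one of them lies in K; disjoint 2-sets are
-- never adjacent, and neither are 2-sets whose symmetric difference lies in E.
--
-- Lower bounds: the C(n,2) pairs inside E together with ⌊m/2⌋ disjoint pairs inside K; for n = 2,
-- the pairs {e₁, k} and {e₂, k} together with ⌊(m - 1)/2⌋ disjoint pairs inside K - k.
--
-- Upper bound by double counting: give every 2-set two distinct tokens so that 2-sets with a common
-- token are equal or adjacent; then 2α is at most the number of tokens. A pair inside K takes its two
-- vertices, a pair inside E two copies of itself, and a pair {e, k} across both copies of the edge
-- {e, e + 1 mod n} of a Hamiltonian cycle on E, which is injective in e once n ≥ 3: 2·C(n,2) + m
-- tokens. For n = 2, {e₁, k} takes one copy of {e₁, e₂} and the token of k, and {e₂, k} the other
-- copy and one extra token: m + 3 tokens.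
module Submission where

open import Defs
open import Data.Bool using (Bool; true; false; not)
open import Data.Empty using (⊥-elim)
open import Data.Fin as Fin using (Fin; zero; suc; toℕ; _↑ˡ_)
open import Data.Fin.Properties using (toℕ-injective; toℕ<n; toℕ-↑ˡ; ↑ˡ-injective)
open import Data.Fin.Subset using (Subset; inside; outside; ⊥; ⁅_⁆; _∪_; _∈_; _∉_; ∣_∣)
open import Data.Fin.Subset.Properties using (∣⁅x⁆∣≡1; x∈⁅x⁆; x∈⁅y⁆⇒x≡y; x∈p∪q⁺; x∈p∪q⁻; ∪-comm; ∪-identityˡ)
open import Data.List using (List; []; _∷_; length; map; _++_; tabulate; upTo)
open import Data.Vec using ([]; _∷_; there)
import Data.Vec.Properties as Vec
open import Data.List.Membership.Propositional using () renaming (_∈_ to _∈ₗ_)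
open import Data.List.Membership.Propositional.Properties using (∈-map⁺; ∈-++⁺ˡ; ∈-++⁺ʳ; ∈-upTo⁺)
open import Data.List.Properties using (length-removeAt′; length-++; length-map; length-tabulate; length-upTo)
open import Data.List.Relation.Binary.Subset.Propositional using (_⊆_)
open import Data.List.Relation.Unary.All as All using (All; []; _∷_)
import Data.List.Relation.Unary.All.Properties as AllP
open import Data.List.Relation.Unary.AllPairs as AP using (AllPairs; []; _∷_)
import Data.List.Relation.Unary.AllPairs.Properties as APP
open import Data.List.Relation.Unary.Any using (here; there; index; _─_)
open import Data.List.Relation.Unary.Unique.Propositional using (Unique)
open import Data.Nat using (ℕ; zero; suc; _+_; _∸_; _<?_; _≤_; _<_; z≤n; s≤s; s≤s⁻¹; z<s; s<s; ⌊_/2⌋; ⌈_/2⌉)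
open import Data.Nat.Combinatorics using (_C_; nC1≡n; nCk+nC[k+1]≡[n+1]C[k+1])
open import Data.Nat.Properties
  using (suc-injective; +-suc; +-comm; +-identityʳ; ≡-irrelevant; ≤-trans; <⇒≤; <⇒≢; <⇒≱; <-irrefl; ≮⇒≥; n<1+n;
         m≤n⇒m<n∨m≡n; m+[n∸m]≡n; m+n∸m≡n; ∸-monoˡ-<; n≡⌊n+n/2⌋; ⌊n/2⌋-mono; module ≤-Reasoning)
open import Data.Product using (_×_; _,_; proj₁; proj₂; ∃; ∃₂; uncurry)
open import Data.Sum as Sum using (_⊎_; inj₁; inj₂)
open import Relation.Binary.PropositionalEquality
  using (_≡_; _≢_; refl; sym; trans; cong; cong₂; subst; module ≡-Reasoning)
open import Relation.Nullary using (¬_; yes; no)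
open import Function using (id; _∘_)
open import Function.Bundles using (_⇔_; mk⇔; Equivalence)
open Equivalence using (to; from)

-- Double counting

module _ {A : Set} where

  ∈-─ : ∀ {x y : A} {ys} (x∈ys : x ∈ₗ ys) → y ∈ₗ ys → y ≢ x → y ∈ₗ (ys ─ x∈ys)
  ∈-─ (here refl)  (here refl)  y≢x = ⊥-elim (y≢x refl)
  ∈-─ (here refl)  (there y∈ys) _   = y∈ys
  ∈-─ (there _)    (here refl)  _   = here refl
  ∈-─ (there x∈ys) (there y∈ys) y≢x = there (∈-─ x∈ys y∈ys y≢x)

  Unique-⊆⇒length≤ : ∀ {xs ys : List A} → Unique xs → xs ⊆ ys → length xs ≤ length ys
  Unique-⊆⇒length≤ {[]} _ _ = z≤n
  Unique-⊆⇒length≤ {x ∷ xs} {ys} (x∉xs ∷ uxs) xs⊆ys = begin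
    suc (length xs)            ≤⟨ s≤s (Unique-⊆⇒length≤ uxs xs⊆ys─x) ⟩
    suc (length (ys ─ x∈ys))   ≡⟨ sym (length-removeAt′ ys (index x∈ys)) ⟩
    length ys                  ∎
    where
    open ≤-Reasoning
    x∈ys : x ∈ₗ ys
    x∈ys = xs⊆ys (here refl)
    xs⊆ys─x : xs ⊆ (ys ─ x∈ys)
    xs⊆ys─x y∈xs = ∈-─ x∈ys (xs⊆ys (there y∈xs)) (λ y≡x → All.lookup x∉xs y∈xs (sym y≡x))

module _ {X T : Set} (τ : X → Bool → T) where

  tokensOf : List X → List T
  tokensOf []       = []
  tokensOf (x ∷ xs) = τ x false ∷ τ x true ∷ tokensOf xs

  double-counting : ∀ {R : X → X → Set} (U : List T) →
                    (∀ x t → τ x t ∈ₗ U) →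
                    (∀ x → τ x false ≢ τ x true) →
                    (∀ {x y} → R x y → ∀ t t′ → τ x t ≢ τ y t′) →
                    ∀ {xs} → AllPairs R xs → length xs + length xs ≤ length U
  double-counting {R} U τ∈U τ-≢ τ-apart {xs} Rxs = begin
    length xs + length xs   ≡⟨ sym (length-tokensOf xs) ⟩
    length (tokensOf xs)    ≤⟨ Unique-⊆⇒length≤ (unique Rxs) (covered xs) ⟩
    length U                ∎
    where
    open ≤-Reasoning
    length-tokensOf : ∀ xs → length (tokensOf xs) ≡ length xs + length xs
    length-tokensOf []       = refl
    length-tokensOf (x ∷ xs) = cong suc (trans (cong suc (length-tokensOf xs)) (sym (+-suc _ _)))
    apart : ∀ {x xs} → All (R x) xs → ∀ t → All (τ x t ≢_) (tokensOf xs)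
    apart []       t = []
    apart (r ∷ rs) t = τ-apart r t false ∷ τ-apart r t true ∷ apart rs t
    unique : ∀ {xs} → AllPairs R xs → Unique (tokensOf xs)
    unique []                = []
    unique {x ∷ _} (rs ∷ Rxs) = (τ-≢ x ∷ apart rs false) ∷ apart rs true ∷ unique Rxs
    covered : ∀ xs → tokensOf xs ⊆ U
    covered (x ∷ xs) (here refl)         = τ∈U x false
    covered (x ∷ xs) (there (here refl)) = τ∈U x true
    covered (x ∷ xs) (there (there t∈))  = covered xs t∈

-- 2-subsets

⦅_,_⦆ : ∀ {N} → Fin N → Fin N → Subset N
⦅ x , y ⦆ = ⁅ x ⁆ ∪ ⁅ y ⁆

module _ {N : ℕ} {x y z : Fin N} where

  ∈⦅⦆⁻ : z ∈ ⦅ x , y ⦆ → z ≡ x ⊎ z ≡ y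
  ∈⦅⦆⁻ z∈ = Sum.map (x∈⁅y⁆⇒x≡y x) (x∈⁅y⁆⇒x≡y y) (x∈p∪q⁻ ⁅ x ⁆ ⁅ y ⁆ z∈)

  ∈⦅⦆⁺ : z ≡ x ⊎ z ≡ y → z ∈ ⦅ x , y ⦆
  ∈⦅⦆⁺ (inj₁ refl) = x∈p∪q⁺ (inj₁ (x∈⁅x⁆ x))
  ∈⦅⦆⁺ (inj₂ refl) = x∈p∪q⁺ (inj₂ (x∈⁅x⁆ y))

⦅⦆-comm : ∀ {N} (x y : Fin N) → ⦅ x , y ⦆ ≡ ⦅ y , x ⦆
⦅⦆-comm x y = ∪-comm ⁅ x ⁆ ⁅ y ⁆

∣p∣≡0⇒p≡⊥ : ∀ {N} (p : Subset N) → ∣ p ∣ ≡ 0 → p ≡ ⊥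
∣p∣≡0⇒p≡⊥ []            _ = refl
∣p∣≡0⇒p≡⊥ (outside ∷ p) e = cong (outside ∷_) (∣p∣≡0⇒p≡⊥ p e)

∣p∣≡1⇒p≡⁅x⁆ : ∀ {N} (p : Subset N) → ∣ p ∣ ≡ 1 → ∃ λ x → p ≡ ⁅ x ⁆
∣p∣≡1⇒p≡⁅x⁆ (inside ∷ p)  e = zero , cong (inside ∷_) (∣p∣≡0⇒p≡⊥ p (suc-injective e))
∣p∣≡1⇒p≡⁅x⁆ (outside ∷ p) e with ∣p∣≡1⇒p≡⁅x⁆ p e
... | x , refl = suc x , refl

∣p∣≡2⇒p≡⦅x,y⦆ : ∀ {N} (p : Subset N) → ∣ p ∣ ≡ 2 →
                ∃₂ λ x y → toℕ x < toℕ y × p ≡ ⦅ x , y ⦆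
∣p∣≡2⇒p≡⦅x,y⦆ (inside ∷ p) e with ∣p∣≡1⇒p≡⁅x⁆ p (suc-injective e)
... | y , refl = zero , suc y , z<s , cong (inside ∷_) (sym (∪-identityˡ ⁅ y ⁆))
∣p∣≡2⇒p≡⦅x,y⦆ (outside ∷ p) e with ∣p∣≡2⇒p≡⦅x,y⦆ p e
... | x , y , x<y , refl = suc x , suc y , s<s x<y , refl

Pointed : ∀ {N} → Subset N → Fin N → Fin N → Set
Pointed p c a = p ≡ ⦅ c , a ⦆ × c ≢ a

TwoSet-≡ : ∀ {N} {A B : TwoSet N} → proj₁ A ≡ proj₁ B → A ≡ B
TwoSet-≡ {A = p , e} {.p , e′} refl = cong (p ,_) (≡-irrelevant e e′)

split : ∀ {N} (A : TwoSet N) → ∃₂ λ x y → toℕ x < toℕ y × proj₁ A ≡ ⦅ x , y ⦆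
split (p , ∣p∣≡2) = ∣p∣≡2⇒p≡⦅x,y⦆ p ∣p∣≡2

-- Adjacency in 2-token graphs

EqualOrAdjacent : ∀ {V} → Graph V → V → V → Set
EqualOrAdjacent H u v = u ≡ v ⊎ Adj H u v

IndependentPair : ∀ {V} → Graph V → V → V → Set
IndependentPair H u v = u ≢ v × ¬ Adj H u v

EqualOrAdjacent-sym : ∀ {V} (H : Graph V) {u v} → EqualOrAdjacent H u v → EqualOrAdjacent H v u
EqualOrAdjacent-sym H = Sum.map sym (adj-sym H)

Disjoint : ∀ {N} → TwoSet N → TwoSet N → Set
Disjoint A B = ∀ z → z ∈ proj₁ A → z ∉ proj₁ B

Below Above : ∀ {N} → ℕ → TwoSet N → Set
Below c A = ∀ z → z ∈ proj₁ A → toℕ z < c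
Above c A = ∀ z → z ∈ proj₁ A → c ≤ toℕ z

below-above⇒disjoint : ∀ {N c} {A B : TwoSet N} → Below c A → Above c B → Disjoint A B
below-above⇒disjoint A<c c≤B z z∈A z∈B = <⇒≱ (A<c z z∈A) (c≤B z z∈B)

¬3-distinct-in-pair : ∀ {N} {x y p q r : Fin N} → p ≢ q → p ≢ r → q ≢ r →
                      p ≡ x ⊎ p ≡ y → q ≡ x ⊎ q ≡ y → ¬ (r ≡ x ⊎ r ≡ y)
¬3-distinct-in-pair p≢q _   _   (inj₁ refl) (inj₁ refl) _           = p≢q refl
¬3-distinct-in-pair p≢q _   _   (inj₂ refl) (inj₂ refl) _           = p≢q refl
¬3-distinct-in-pair _   p≢r _   (inj₁ refl) (inj₂ refl) (inj₁ refl) = p≢r refl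
¬3-distinct-in-pair _   _   q≢r (inj₁ refl) (inj₂ refl) (inj₂ refl) = q≢r refl
¬3-distinct-in-pair _   _   q≢r (inj₂ refl) (inj₁ refl) (inj₁ refl) = q≢r refl
¬3-distinct-in-pair _   p≢r _   (inj₂ refl) (inj₁ refl) (inj₂ refl) = p≢r refl

Δ-sharing : ∀ {N} {a b c z : Fin N} → c ≢ a → c ≢ b → a ≢ b →
            z ∈Δ ⦅ c , a ⦆ , ⦅ c , b ⦆ ⇔ (z ≡ a ⊎ z ≡ b)
Δ-sharing {a = a} {b} {c} c≢a c≢b a≢b = mk⇔ (Sum.map (uncurry leaf) (uncurry leaf)) Δ⁺
  where
  leaf : ∀ {d e z} → z ∈ ⦅ c , d ⦆ → z ∉ ⦅ c , e ⦆ → z ≡ d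
  leaf z∈ z∉ = Sum.[ (λ { refl → ⊥-elim (z∉ (∈⦅⦆⁺ (inj₁ refl))) }) , id ] (∈⦅⦆⁻ z∈)
  Δ⁺ : ∀ {z} → z ≡ a ⊎ z ≡ b → z ∈Δ ⦅ c , a ⦆ , ⦅ c , b ⦆
  Δ⁺ (inj₁ refl) = inj₁ (∈⦅⦆⁺ (inj₂ refl) , Sum.[ c≢a ∘ sym , a≢b ] ∘ ∈⦅⦆⁻)
  Δ⁺ (inj₂ refl) = inj₂ (∈⦅⦆⁺ (inj₂ refl) , Sum.[ c≢b ∘ sym , a≢b ∘ sym ] ∘ ∈⦅⦆⁻)

module _ {N} (G : Graph (Fin N)) where

  sharing⇒EqualOrAdjacent : ∀ {A B : TwoSet N} {a b c} → Pointed (proj₁ A) c a → Pointed (proj₁ B) c b →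
                            (a ≢ b → Adj G a b) → EqualOrAdjacent (F2 G) A B
  sharing⇒EqualOrAdjacent {_ , _} {_ , _} {a} {b} (refl , c≢a) (refl , c≢b) ab with a Fin.≟ b
  ... | yes refl = inj₁ (TwoSet-≡ refl)
  ... | no a≢b   = inj₂ (a , b , ab a≢b , λ _ → Δ-sharing c≢a c≢b a≢b)

  disjoint⇒independent : ∀ {A B : TwoSet N} → Disjoint A B → IndependentPair (F2 G) A B
  disjoint⇒independent {A} {B} A∩B=∅ with split A | split B
  ... | a₁ , a₂ , a₁<a₂ , A≡ | b₁ , _ , _ , B≡ = A≢B , ¬A~B
    where
    a₁∈A : a₁ ∈ proj₁ A
    a₁∈A = subst (a₁ ∈_) (sym A≡) (∈⦅⦆⁺ (inj₁ refl))
    a₂∈A : a₂ ∈ proj₁ A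
    a₂∈A = subst (a₂ ∈_) (sym A≡) (∈⦅⦆⁺ (inj₂ refl))
    b₁∈B : b₁ ∈ proj₁ B
    b₁∈B = subst (b₁ ∈_) (sym B≡) (∈⦅⦆⁺ (inj₁ refl))
    A≢B : A ≢ B
    A≢B refl = A∩B=∅ a₁ a₁∈A a₁∈A
    ¬A~B : ¬ F2Adj (Adj G) A B
    ¬A~B (x , y , _ , Δ⇔) = ¬3-distinct-in-pair
      (λ { refl → <-irrefl refl a₁<a₂ })
      (λ { refl → A∩B=∅ a₁ a₁∈A b₁∈B })
      (λ { refl → A∩B=∅ a₂ a₂∈A b₁∈B })
      (to (Δ⇔ a₁) (inj₁ (a₁∈A , A∩B=∅ a₁ a₁∈A)))
      (to (Δ⇔ a₂) (inj₁ (a₂∈A , A∩B=∅ a₂ a₂∈A)))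
      (to (Δ⇔ b₁) (inj₂ (b₁∈B , λ b₁∈A → A∩B=∅ b₁ b₁∈A b₁∈B)))

  below-above⇒independent : ∀ {c xs ys} → All (Below c) xs → All (Above c) ys →
                            All (λ A → All (IndependentPair (F2 G) A) ys) xs
  below-above⇒independent {c} xs<c c≤ys = All.map (λ A<c → All.map (cross A<c) c≤ys) xs<c
    where
    cross : ∀ {A B} → Below c A → Above c B → IndependentPair (F2 G) A B
    cross {A} {B} A<c c≤B = disjoint⇒independent (below-above⇒disjoint {c = c} {A} {B} A<c c≤B)

-- Independent sets

[1+n]C2≡n+nC2 : ∀ n → suc n C 2 ≡ n + n C 2
[1+n]C2≡n+nC2 n = trans (sym (nCk+nC[k+1]≡[n+1]C[k+1] n 1)) (cong (_+ n C 2) (nC1≡n n))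

shift : ∀ {N} → TwoSet N → TwoSet (suc N)
shift (p , ∣p∣≡2) = outside ∷ p , ∣p∣≡2

shiftBy : ∀ {N} k → TwoSet N → TwoSet (k + N)
shiftBy zero    A = A
shiftBy (suc k) A = shift (shiftBy k A)

pair₀ : ∀ {N} → Fin N → TwoSet (suc N)
pair₀ y = inside ∷ ⁅ y ⁆ , cong suc (∣⁅x⁆∣≡1 y)

module _ {N : ℕ} where

  shift-injective : {A B : TwoSet N} → shift A ≡ shift B → A ≡ B
  shift-injective = TwoSet-≡ ∘ Vec.∷-injectiveʳ ∘ cong proj₁

  pair₀-injective : {x y : Fin N} → pair₀ x ≡ pair₀ y → x ≡ y
  pair₀-injective {x} {y} eq =
    x∈⁅y⁆⇒x≡y y (subst (x ∈_) (Vec.∷-injectiveʳ (cong proj₁ eq)) (x∈⁅x⁆ x))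

  shift-below : ∀ {c} {A : TwoSet N} → Below c A → Below (suc c) (shift A)
  shift-below A<c (suc z) (there z∈A) = s<s (A<c z z∈A)

  shift-above : ∀ {c} {A : TwoSet N} → Above c A → Above (suc c) (shift A)
  shift-above c≤A (suc z) (there z∈A) = s≤s (c≤A z z∈A)

  shift-disjoint : {A B : TwoSet N} → Disjoint A B → Disjoint (shift A) (shift B)
  shift-disjoint A∩B=∅ (suc z) (there z∈A) (there z∈B) = A∩B=∅ z z∈A z∈B

  pair₀-below : ∀ {c} {y : Fin N} → toℕ y < c → Below (suc c) (pair₀ y)
  pair₀-below y<c zero    _           = z<s
  pair₀-below y<c (suc z) (there z∈⁅y⁆) rewrite x∈⁅y⁆⇒x≡y _ z∈⁅y⁆ = s<s y<c

shiftBy-above : ∀ {N} k (A : TwoSet N) → Above k (shiftBy k A)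
shiftBy-above zero    A _ _ = z≤n
shiftBy-above (suc k) A = shift-above {A = shiftBy k A} (shiftBy-above k A)

shiftBy-disjoint : ∀ {N} k {A B : TwoSet N} → Disjoint A B → Disjoint (shiftBy k A) (shiftBy k B)
shiftBy-disjoint zero    A∩B=∅ = A∩B=∅
shiftBy-disjoint (suc k) {A} {B} A∩B=∅ =
  shift-disjoint {A = shiftBy k A} {shiftBy k B} (shiftBy-disjoint k A∩B=∅)

E-pairs : (n m : ℕ) → List (TwoSet (n + m))
E-pairs zero    m = []
E-pairs (suc n) m = tabulate (pair₀ ∘ (_↑ˡ m)) ++ map shift (E-pairs n m)

length-E-pairs : ∀ n m → length (E-pairs n m) ≡ n C 2
length-E-pairs zero    m = refl
length-E-pairs (suc n) m = begin
  length (row ++ map shift (E-pairs n m))     ≡⟨ length-++ row ⟩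
  length row + length (map shift (E-pairs n m))
    ≡⟨ cong₂ _+_ (length-tabulate _) (trans (length-map shift (E-pairs n m)) (length-E-pairs n m)) ⟩
  n + n C 2                                   ≡⟨ sym ([1+n]C2≡n+nC2 n) ⟩
  suc n C 2                                   ∎
  where
  open ≡-Reasoning
  row : List (TwoSet (suc n + m))
  row = tabulate {n = n} (pair₀ ∘ (_↑ˡ m))

E-pairs-below : ∀ n m → All (Below n) (E-pairs n m)
E-pairs-below zero    m = []
E-pairs-below (suc n) m = AllP.++⁺
  (AllP.tabulate⁺ λ y → pair₀-below (subst (_< n) (sym (toℕ-↑ˡ y m)) (toℕ<n y)))
  (AllP.map⁺ (All.map (λ {A} → shift-below {A = A}) (E-pairs-below n m)))

E-pairs-unique : ∀ n m → Unique (E-pairs n m)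
E-pairs-unique zero    m = []
E-pairs-unique (suc n) m = APP.++⁺
  (APP.tabulate⁺ λ y≢y′ → y≢y′ ∘ ↑ˡ-injective m _ _ ∘ pair₀-injective)
  (APP.map⁺ (AP.map (_∘ shift-injective) (E-pairs-unique n m)))
  (AllP.tabulate⁺ λ _ → AllP.map⁺ (All.universal (λ _ ()) (E-pairs n m)))

matching : (m : ℕ) → List (TwoSet m)
matching zero          = []
matching (suc zero)    = []
matching (suc (suc m)) = pair₀ zero ∷ map (shiftBy 2) (matching m)

length-matching : ∀ m → length (matching m) ≡ ⌊ m /2⌋
length-matching zero          = refl
length-matching (suc zero)    = refl
length-matching (suc (suc m)) = cong suc (trans (length-map (shiftBy 2) (matching m)) (length-matching m))

matching-disjoint : ∀ m → AllPairs Disjoint (matching m)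
matching-disjoint zero          = []
matching-disjoint (suc zero)    = []
matching-disjoint (suc (suc m)) =
  AllP.map⁺ (All.universal first-apart (matching m))
  ∷ APP.map⁺ (AP.map (λ {A} {B} → shiftBy-disjoint 2 {A} {B}) (matching-disjoint m))
  where
  first-apart : ∀ B → Disjoint (pair₀ zero) (shiftBy 2 B)
  first-apart B = below-above⇒disjoint {c = 2} {pair₀ zero} {shiftBy 2 B} (pair₀-below z<s) (shiftBy-above 2 B)

matchingAbove : ∀ k m → List (TwoSet (k + m))
matchingAbove k m = map (shiftBy k) (matching m)

length-matchingAbove : ∀ k m → length (matchingAbove k m) ≡ ⌊ m /2⌋
length-matchingAbove k m = trans (length-map (shiftBy k) (matching m)) (length-matching m)

matchingAbove-above : ∀ k m → All (Above k) (matchingAbove k m)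
matchingAbove-above k m = AllP.map⁺ (All.universal (shiftBy-above k) (matching m))

matchingAbove-independent : ∀ k m (G : Graph (Fin (k + m))) → IsIndependent (F2 G) (matchingAbove k m)
matchingAbove-independent k m G =
  APP.map⁺ (AP.map (λ {A} {B} → disjoint⇒independent G ∘ shiftBy-disjoint k {A} {B}) (matching-disjoint m))

module _ {n m : ℕ} where

  ¬adj-if-Δ⊆E : {A B : TwoSet (n + m)} → (∀ z → z ∈Δ proj₁ A , proj₁ B → toℕ z < n) →
                ¬ Adj (F2 (EK n m)) A B
  ¬adj-if-Δ⊆E Δ<n (x , _ , (_ , inj₁ n≤x) , Δ⇔) = <⇒≱ (Δ<n x (from (Δ⇔ x) (inj₁ refl))) n≤x
  ¬adj-if-Δ⊆E Δ<n (_ , y , (_ , inj₂ n≤y) , Δ⇔) = <⇒≱ (Δ<n y (from (Δ⇔ y) (inj₂ refl))) n≤y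

  below⇒¬adj : ∀ {A B : TwoSet (n + m)} → Below n A → Below n B → ¬ Adj (F2 (EK n m)) A B
  below⇒¬adj {A} {B} A<n B<n = ¬adj-if-Δ⊆E {A} {B} λ
    { z (inj₁ (z∈A , _)) → A<n z z∈A
    ; z (inj₂ (z∈B , _)) → B<n z z∈B }

  below-unique⇒independent : ∀ {xs} → All (Below n) xs → Unique xs → IsIndependent (F2 (EK n m)) xs
  below-unique⇒independent []           []           = []
  below-unique⇒independent {A ∷ _} (A<n ∷ xs<n) (A∉xs ∷ uxs) =
    All.zipWith (λ {B} (B<n , A≢B) → A≢B , below⇒¬adj {A} {B} A<n B<n) (xs<n , A∉xs)
    ∷ below-unique⇒independent xs<n uxs

independent-E-pairs+matching : ∀ n m →
  ∃ λ xs → IsIndependent (F2 (EK n m)) xs × length xs ≡ ⌊ m /2⌋ + n C 2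
independent-E-pairs+matching n m = E-pairs n m ++ matchingAbove n m , independent , size
  where
  independent : IsIndependent (F2 (EK n m)) (E-pairs n m ++ matchingAbove n m)
  independent = APP.++⁺
    (below-unique⇒independent (E-pairs-below n m) (E-pairs-unique n m))
    (matchingAbove-independent n m (EK n m))
    (below-above⇒independent (EK n m) (E-pairs-below n m) (matchingAbove-above n m))
  size : length (E-pairs n m ++ matchingAbove n m) ≡ ⌊ m /2⌋ + n C 2
  size = begin
    length (E-pairs n m ++ matchingAbove n m)        ≡⟨ length-++ (E-pairs n m) ⟩
    length (E-pairs n m) + length (matchingAbove n m) ≡⟨ cong₂ _+_ (length-E-pairs n m) (length-matchingAbove n m) ⟩
    n C 2 + ⌊ m /2⌋                                 ≡⟨ +-comm (n C 2) ⌊ m /2⌋ ⟩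
    ⌊ m /2⌋ + n C 2                                 ∎
    where open ≡-Reasoning

⌈[m+3]/2⌉≡2+⌊m/2⌋ : ∀ m → ⌈ (suc m + 2) /2⌉ ≡ 2 + ⌊ m /2⌋
⌈[m+3]/2⌉≡2+⌊m/2⌋ m = cong (λ k → suc ⌊ k /2⌋) (+-comm m 2)

independent-n≡2 : ∀ m → ∃ λ xs → IsIndependent (F2 (EK 2 (suc m))) xs × length xs ≡ ⌈ (suc m + 2) /2⌉
independent-n≡2 m = s₀ ∷ s₁ ∷ matchingAbove 3 m , independent , size
  where
  -- {0, 2} and {1, 2}: their symmetric difference {0, 1} lies in E.
  s₀ s₁ : TwoSet (3 + m)
  s₀ = pair₀ (suc zero)
  s₁ = shift (pair₀ zero)
  Δ<2 : ∀ z → z ∈Δ proj₁ s₀ , proj₁ s₁ → toℕ z < 2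
  Δ<2 zero          _                              = z<s
  Δ<2 (suc zero)    _                              = s<s z<s
  Δ<2 (suc (suc z)) (inj₁ (there (there z∈) , z∉)) = ⊥-elim (z∉ (there (there z∈)))
  Δ<2 (suc (suc z)) (inj₂ (there (there z∈) , z∉)) = ⊥-elim (z∉ (there (there z∈)))
  s₀,s₁<3 : All (Below 3) (s₀ ∷ s₁ ∷ [])
  s₀,s₁<3 = pair₀-below (s<s z<s) ∷ shift-below {A = pair₀ zero} (pair₀-below z<s) ∷ []
  independent : IsIndependent (F2 (EK 2 (suc m))) (s₀ ∷ s₁ ∷ matchingAbove 3 m)
  independent = APP.++⁺ {xs = s₀ ∷ s₁ ∷ []}
    ((((λ ()) , ¬adj-if-Δ⊆E {A = s₀} {s₁} Δ<2) ∷ []) ∷ [] ∷ [])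
    (matchingAbove-independent 3 m (EK 2 (suc m)))
    (below-above⇒independent (EK 2 (suc m)) s₀,s₁<3 (matchingAbove-above 3 m))
  size : length (s₀ ∷ s₁ ∷ matchingAbove 3 m) ≡ ⌈ (suc m + 2) /2⌉
  size = trans (cong (2 +_) (length-matchingAbove 3 m)) (sym (⌈[m+3]/2⌉≡2+⌊m/2⌋ m))

-- Tokens

-- edge a b t is copy t of the pair {a, b} in E, vertex k stands for k ∈ K, and extra is needed only when n = 2.
data Token : Set where
  edge   : ℕ → ℕ → Bool → Token
  vertex : ℕ → Token
  extra  : Token

edge-injective : ∀ {a b t a′ b′ t′} → edge a b t ≡ edge a′ b′ t′ → a ≡ a′ × b ≡ b′
edge-injective refl = refl , refl

vertex-injective : ∀ {k l} → vertex k ≡ vertex l → k ≡ l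
vertex-injective refl = refl

pairsBelow : ℕ → List (ℕ × ℕ)
pairsBelow zero    = []
pairsBelow (suc b) = pairsBelow b ++ map (_, b) (upTo b)

∈-pairsBelow : ∀ {a b n} → a < b → b < n → (a , b) ∈ₗ pairsBelow n
∈-pairsBelow {n = suc n} a<b (s≤s b≤n) with m≤n⇒m<n∨m≡n b≤n
... | inj₁ b<n  = ∈-++⁺ˡ (∈-pairsBelow a<b b<n)
... | inj₂ refl = ∈-++⁺ʳ (pairsBelow n) (∈-map⁺ (_, n) (∈-upTo⁺ a<b))

length-pairsBelow : ∀ n → length (pairsBelow n) ≡ n C 2
length-pairsBelow zero    = refl
length-pairsBelow (suc n) = begin
  length (pairsBelow n ++ map (_, n) (upTo n))         ≡⟨ length-++ (pairsBelow n) ⟩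
  length (pairsBelow n) + length (map (_, n) (upTo n))
    ≡⟨ cong₂ _+_ (length-pairsBelow n) (trans (length-map (_, n) (upTo n)) (length-upTo n)) ⟩
  n C 2 + n                                            ≡⟨ +-comm (n C 2) n ⟩
  n + n C 2                                            ≡⟨ sym ([1+n]C2≡n+nC2 n) ⟩
  suc n C 2                                            ∎
  where open ≡-Reasoning

edgeTokens : ℕ → Bool → List Token
edgeTokens n t = map (λ (a , b) → edge a b t) (pairsBelow n)

vertexTokens : ℕ → ℕ → List Token
vertexTokens n m = map (λ k → vertex (n + k)) (upTo m)

universe : List Token → ℕ → ℕ → List Token
universe extras n m = extras ++ edgeTokens n false ++ edgeTokens n true ++ vertexTokens n m

module _ (extras : List Token) (n m : ℕ) where

  length-universe : length (universe extras n m) ≡ length extras + (n C 2 + (n C 2 + m))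
  length-universe = trans (length-++ extras) (cong (length extras +_)
    (trans (length-++ (edgeTokens n false)) (cong₂ _+_ (length-edgeTokens false)
      (trans (length-++ (edgeTokens n true)) (cong₂ _+_ (length-edgeTokens true) length-vertexTokens)))))
    where
    length-edgeTokens : ∀ t → length (edgeTokens n t) ≡ n C 2
    length-edgeTokens t = trans (length-map _ (pairsBelow n)) (length-pairsBelow n)
    length-vertexTokens : length (vertexTokens n m) ≡ m
    length-vertexTokens = trans (length-map _ (upTo m)) (length-upTo m)

  edge-∈ : ∀ {a b} → a < b → b < n → ∀ t → edge a b t ∈ₗ universe extras n m
  edge-∈ a<b b<n false = ∈-++⁺ʳ extras (∈-++⁺ˡ (∈-map⁺ _ (∈-pairsBelow a<b b<n)))
  edge-∈ a<b b<n true  =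
    ∈-++⁺ʳ extras (∈-++⁺ʳ (edgeTokens n false) (∈-++⁺ˡ (∈-map⁺ _ (∈-pairsBelow a<b b<n))))

  vertex-∈ : ∀ {k} → n ≤ k → k < n + m → vertex k ∈ₗ universe extras n m
  vertex-∈ {k} n≤k k<n+m = ∈-++⁺ʳ extras (∈-++⁺ʳ (edgeTokens n false) (∈-++⁺ʳ (edgeTokens n true)
    (subst (λ l → vertex l ∈ₗ vertexTokens n m) (m+[n∸m]≡n n≤k)
      (∈-map⁺ _ (∈-upTo⁺ (subst (k ∸ n <_) (m+n∸m≡n n m) (∸-monoˡ-< k<n+m n≤k)))))))

-- Tokens for the 2-sets {i, k} with i ∈ E and k ∈ K. The conditions are what makes two 2-sets with a
-- common token share a vertex whose other ends are equal or include a vertex of K.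
record Charging (n m : ℕ) (extras : List Token) : Set where
  field
    charge        : ℕ → ℕ → Bool → Token
    charge-∈      : ∀ {i k} → i < n → n ≤ k → k < n + m →
                    ∀ t → charge i k t ∈ₗ universe extras n m
    charge-≢      : ∀ i k → charge i k false ≢ charge i k true
    charge-edge   : ∀ {i k t a b t′} → i < n → charge i k t ≡ edge a b t′ → i ≡ a ⊎ i ≡ b
    charge-vertex : ∀ {i k t l} → charge i k t ≡ vertex l → l ≡ k
    charge-center : ∀ {i i′ k k′ t t′} → i < n → i′ < n →
                    charge i k t ≡ charge i′ k′ t′ → i ≡ i′

end : ∀ {N} → Bool → Fin N → Fin N → Fin N
end false x _ = x
end true  _ y = y

module UpperBound {n m : ℕ} {extras : List Token} (χ : Charging n m extras) where
  open Charging χ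

  data Class (x y : Fin (n + m)) : Set where
    within-E : toℕ y < n → Class x y
    across   : toℕ x < n → n ≤ toℕ y → Class x y
    within-K : n ≤ toℕ x → Class x y

  classify : ∀ x y → Class x y
  classify x y with toℕ y <? n | toℕ x <? n
  ... | yes y<n | _       = within-E y<n
  ... | no y≮n  | yes x<n = across x<n (≮⇒≥ y≮n)
  ... | no _    | no x≮n  = within-K (≮⇒≥ x≮n)

  token : ∀ {x y} → Class x y → Bool → Token
  token {x} {y} (within-E _) t = edge (toℕ x) (toℕ y) t
  token {x} {y} (across _ _) t = charge (toℕ x) (toℕ y) t
  token {x} {y} (within-K _) t = vertex (toℕ (end t x y))

  τ : TwoSet (n + m) → Bool → Token
  τ A = tokenOf (split A)
    where tokenOf : (∃₂ λ x y → toℕ x < toℕ y × proj₁ A ≡ ⦅ x , y ⦆) → Bool → Token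
          tokenOf (x , y , _) = token (classify x y)

  n≤end : ∀ {x y : Fin (n + m)} → n ≤ toℕ x → toℕ x < toℕ y → ∀ t → n ≤ toℕ (end t x y)
  n≤end n≤x x<y false = n≤x
  n≤end n≤x x<y true  = ≤-trans n≤x (<⇒≤ x<y)

  pointed-end : ∀ {p : Subset (n + m)} {x y} → p ≡ ⦅ x , y ⦆ → toℕ x < toℕ y →
                ∀ t → Pointed p (end t x y) (end (not t) x y)
  pointed-end p≡ x<y false = p≡ , <⇒≢ x<y ∘ cong toℕ
  pointed-end p≡ x<y true  = trans p≡ (⦅⦆-comm _ _) , <⇒≢ x<y ∘ cong toℕ ∘ sym

  share : ∀ {A B : TwoSet (n + m)} {c c′ a b} → Pointed (proj₁ A) c a → Pointed (proj₁ B) c′ b →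
          toℕ c ≡ toℕ c′ → n ≤ toℕ a ⊎ n ≤ toℕ b → EqualOrAdjacent (F2 (EK n m)) A B
  share {A} {B} A⟨c,a⟩ B⟨c′,b⟩ c≡c′ K with toℕ-injective c≡c′
  ... | refl = sharing⇒EqualOrAdjacent (EK n m) {A} {B} A⟨c,a⟩ B⟨c′,b⟩ (_, K)

  conflict : ∀ {A B : TwoSet (n + m)} {x y x′ y′} →
             proj₁ A ≡ ⦅ x , y ⦆ → proj₁ B ≡ ⦅ x′ , y′ ⦆ →
             toℕ x < toℕ y → toℕ x′ < toℕ y′ → (c : Class x y) (c′ : Class x′ y′) →
             ∀ t t′ → token c t ≡ token c′ t′ → EqualOrAdjacent (F2 (EK n m)) A B
  conflict A≡ B≡ x<y x′<y′ (within-E _) (within-E _) t t′ eq with edge-injective eq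
  ... | x≡x′ , y≡y′ =
    inj₁ (TwoSet-≡ (trans A≡ (trans (cong₂ ⦅_,_⦆ (toℕ-injective x≡x′) (toℕ-injective y≡y′)) (sym B≡))))
  conflict A≡ B≡ x<y x′<y′ (within-E _) (across x′<n n≤y′) t t′ eq with charge-edge x′<n (sym eq)
  ... | inj₁ x′≡x = share (pointed-end A≡ x<y false) (pointed-end B≡ x′<y′ false) (sym x′≡x) (inj₂ n≤y′)
  ... | inj₂ x′≡y = share (pointed-end A≡ x<y true)  (pointed-end B≡ x′<y′ false) (sym x′≡y) (inj₂ n≤y′)
  conflict _ _ _ _ (within-E _) (within-K _) _ _ ()
  conflict A≡ B≡ x<y x′<y′ (across x<n n≤y) (across x′<n _) t t′ eq =
    share (pointed-end A≡ x<y false) (pointed-end B≡ x′<y′ false) (charge-center x<n x′<n eq) (inj₁ n≤y)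
  conflict A≡ B≡ x<y x′<y′ (across _ _) (within-K n≤x′) t t′ eq =
    share (pointed-end A≡ x<y true) (pointed-end B≡ x′<y′ t′) (sym (charge-vertex eq))
          (inj₂ (n≤end n≤x′ x′<y′ (not t′)))
  conflict A≡ B≡ x<y x′<y′ (within-K n≤x) (within-K _) t t′ eq =
    share (pointed-end A≡ x<y t) (pointed-end B≡ x′<y′ t′) (vertex-injective eq)
          (inj₁ (n≤end n≤x x<y (not t)))
  conflict _ _ _ _ (within-K _) (within-E _) _ _ ()
  conflict A≡ B≡ x<y x′<y′ c@(across _ _) c′@(within-E _) t t′ eq =
    EqualOrAdjacent-sym (F2 (EK n m)) (conflict B≡ A≡ x′<y′ x<y c′ c t′ t (sym eq))
  conflict A≡ B≡ x<y x′<y′ c@(within-K _) c′@(across _ _) t t′ eq =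
    EqualOrAdjacent-sym (F2 (EK n m)) (conflict B≡ A≡ x′<y′ x<y c′ c t′ t (sym eq))

  τ-∈ : ∀ A t → τ A t ∈ₗ universe extras n m
  τ-∈ A t with split A
  ... | x , y , x<y , _ with classify x y
  ...   | within-E y<n   = edge-∈ extras n m x<y y<n t
  ...   | across x<n n≤y = charge-∈ x<n n≤y (toℕ<n y) t
  ...   | within-K n≤x   = vertex-∈ extras n m (n≤end n≤x x<y t) (toℕ<n (end t x y))

  τ-≢ : ∀ A → τ A false ≢ τ A true
  τ-≢ A with split A
  ... | x , y , x<y , _ with classify x y
  ...   | within-E _   = λ ()
  ...   | across _ _   = charge-≢ (toℕ x) (toℕ y)
  ...   | within-K _   = <⇒≢ x<y ∘ vertex-injective

  τ-apart : ∀ {A B} → IndependentPair (F2 (EK n m)) A B → ∀ t t′ → τ A t ≢ τ B t′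
  τ-apart {A} {B} (A≢B , ¬A~B) t t′ eq with split A | split B
  ... | x , y , x<y , A≡ | x′ , y′ , x′<y′ , B≡ =
    Sum.[ A≢B , ¬A~B ] (conflict A≡ B≡ x<y x′<y′ (classify x y) (classify x′ y′) t t′ eq)

  upper-bound : ∀ {xs} → IsIndependent (F2 (EK n m)) xs →
                length xs + length xs ≤ length extras + (n C 2 + (n C 2 + m))
  upper-bound independent = subst (_ ≤_) (length-universe extras n m)
    (double-counting τ (universe extras n m) τ-∈ τ-≢ τ-apart independent)

-- Copy t of the edge {i, i + 1 mod n} of a Hamiltonian cycle on E.
cycleEdge : ℕ → ℕ → Bool → Token
cycleEdge n i t with suc i <? n
... | yes _ = edge i (suc i) t
... | no  _ = edge 0 i t

cycleCharging : ∀ {n m} → 3 ≤ n → Charging n m []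
cycleCharging {n} {m} 3≤n = record
  { charge        = λ i _ → cycleEdge n i
  ; charge-∈      = λ i<n _ _ → cycleEdge-∈ i<n
  ; charge-≢      = λ i _ → cycleEdge-≢ i
  ; charge-edge   = λ _ → cycleEdge-edge
  ; charge-vertex = λ eq → ⊥-elim (cycleEdge-≢vertex eq)
  ; charge-center = λ _ _ → cycleEdge-injective
  }
  where
  cycleEdge-∈ : ∀ {i} → i < n → ∀ t → cycleEdge n i t ∈ₗ universe [] n m
  cycleEdge-∈ {i} i<n t with suc i <? n
  ... | yes i+1<n = edge-∈ [] n m (n<1+n i) i+1<n t
  ... | no  i+1≮n = edge-∈ [] n m (≤-trans (s≤s z≤n) (s≤s⁻¹ (≤-trans 3≤n (≮⇒≥ i+1≮n)))) i<n t

  cycleEdge-≢ : ∀ i → cycleEdge n i false ≢ cycleEdge n i true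
  cycleEdge-≢ i with suc i <? n
  ... | yes _ = λ ()
  ... | no  _ = λ ()

  cycleEdge-edge : ∀ {i t a b t′} → cycleEdge n i t ≡ edge a b t′ → i ≡ a ⊎ i ≡ b
  cycleEdge-edge {i} eq with suc i <? n
  ... | yes _ = inj₁ (proj₁ (edge-injective eq))
  ... | no  _ = inj₂ (proj₂ (edge-injective eq))

  cycleEdge-≢vertex : ∀ {i t l} → cycleEdge n i t ≢ vertex l
  cycleEdge-≢vertex {i} with suc i <? n
  ... | yes _ = λ ()
  ... | no  _ = λ ()

  -- The closing edge {0, n - 1} is no {i, i + 1} since n ≥ 3.
  closing≢ : ∀ {i j t t′} → ¬ suc j < n → edge i (suc i) t ≢ edge 0 j t′
  closing≢ 2≮n refl = 2≮n 3≤n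

  cycleEdge-injective : ∀ {i i′ t t′} → cycleEdge n i t ≡ cycleEdge n i′ t′ → i ≡ i′
  cycleEdge-injective {i} {i′} eq with suc i <? n | suc i′ <? n
  ... | yes _     | yes _     = proj₁ (edge-injective eq)
  ... | no  _     | no  _     = proj₂ (edge-injective eq)
  ... | yes _     | no i′+1≮n = ⊥-elim (closing≢ i′+1≮n eq)
  ... | no i+1≮n  | yes _     = ⊥-elim (closing≢ i+1≮n (sym eq))

charge₂ : ℕ → ℕ → Bool → Token
charge₂ zero    k false = edge 0 1 false
charge₂ zero    k true  = vertex k
charge₂ (suc _) _ false = edge 0 1 true
charge₂ (suc _) _ true  = extra

side : Token → ℕ
side (edge _ _ false) = 0
side (edge _ _ true)  = 1
side (vertex _)       = 0
side extra            = 1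

charging₂ : ∀ {m} → Charging 2 m (extra ∷ [])
charging₂ {m} = record
  { charge        = charge₂
  ; charge-∈      = charge₂-∈
  ; charge-≢      = λ { zero _ () ; (suc _) _ () }
  ; charge-edge   = charge₂-edge
  ; charge-vertex = charge₂-vertex
  ; charge-center = λ i<2 i′<2 eq → trans (sym (side-charge₂ i<2)) (trans (cong side eq) (side-charge₂ i′<2))
  }
  where
  charge₂-∈ : ∀ {i k} → i < 2 → 2 ≤ k → k < 2 + m →
              ∀ t → charge₂ i k t ∈ₗ universe (extra ∷ []) 2 m
  charge₂-∈ {zero}     _ _   _     false = edge-∈ (extra ∷ []) 2 m z<s (s<s z<s) false
  charge₂-∈ {zero}     _ 2≤k k<2+m true  = vertex-∈ (extra ∷ []) 2 m 2≤k k<2+m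
  charge₂-∈ {suc zero} _ _   _     false = edge-∈ (extra ∷ []) 2 m z<s (s<s z<s) true
  charge₂-∈ {suc zero} _ _   _     true  = here refl
  charge₂-∈ {suc (suc _)} (s<s (s<s ()))

  charge₂-edge : ∀ {i k t a b t′} → i < 2 → charge₂ i k t ≡ edge a b t′ → i ≡ a ⊎ i ≡ b
  charge₂-edge {zero}     {t = false} _ eq = inj₁ (proj₁ (edge-injective eq))
  charge₂-edge {suc zero} {t = false} _ eq = inj₂ (proj₂ (edge-injective eq))
  charge₂-edge {suc (suc _)} (s<s (s<s ()))
  charge₂-edge {zero}  {t = true} _ ()
  charge₂-edge {suc _} {t = true} _ ()

  charge₂-vertex : ∀ {i k t l} → charge₂ i k t ≡ vertex l → l ≡ k
  charge₂-vertex {zero} {t = true} refl = refl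
  charge₂-vertex {zero} {t = false} ()
  charge₂-vertex {suc _} {t = false} ()
  charge₂-vertex {suc _} {t = true} ()

  side-charge₂ : ∀ {i k t} → i < 2 → side (charge₂ i k t) ≡ i
  side-charge₂ {zero}     {t = false} _ = refl
  side-charge₂ {zero}     {t = true}  _ = refl
  side-charge₂ {suc zero} {t = false} _ = refl
  side-charge₂ {suc zero} {t = true}  _ = refl
  side-charge₂ {suc (suc _)} (s<s (s<s ()))

-- The independence number

half-bound : ∀ {l k} → l + l ≤ k → l ≤ ⌊ k /2⌋
half-bound {l} l+l≤k = subst (_≤ _) (sym (n≡⌊n+n/2⌋ l)) (⌊n/2⌋-mono l+l≤k)

⌊[n+[n+m]]/2⌋≡⌊m/2⌋+n : ∀ n m → ⌊ n + (n + m) /2⌋ ≡ ⌊ m /2⌋ + n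
⌊[n+[n+m]]/2⌋≡⌊m/2⌋+n zero    m = sym (+-identityʳ ⌊ m /2⌋)
⌊[n+[n+m]]/2⌋≡⌊m/2⌋+n (suc n) m = begin
  ⌊ suc n + (suc n + m) /2⌋   ≡⟨ cong (λ k → ⌊ suc k /2⌋) (+-suc n (n + m)) ⟩
  suc ⌊ n + (n + m) /2⌋       ≡⟨ cong suc (⌊[n+[n+m]]/2⌋≡⌊m/2⌋+n n m) ⟩
  suc (⌊ m /2⌋ + n)           ≡⟨ sym (+-suc ⌊ m /2⌋ n) ⟩
  ⌊ m /2⌋ + suc n             ∎
  where open ≡-Reasoning

α-n≥3 : ∀ {n m} → 3 ≤ n → IndependenceNumber (F2 (EK n m)) (⌊ m /2⌋ + n C 2)
α-n≥3 {n} {m} 3≤n = independent-E-pairs+matching n m , λ xs independent →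
  subst (length xs ≤_) (⌊[n+[n+m]]/2⌋≡⌊m/2⌋+n (n C 2) m)
    (half-bound (UpperBound.upper-bound (cycleCharging 3≤n) independent))

α-n≡2 : ∀ m → IndependenceNumber (F2 (EK 2 (suc m))) ⌈ (suc m + 2) /2⌉
α-n≡2 m = independent-n≡2 m , λ xs independent →
  subst (length xs ≤_) (sym (⌈[m+3]/2⌉≡2+⌊m/2⌋ m))
    (half-bound (UpperBound.upper-bound charging₂ independent))

theorem7 : (m n : ℕ) → 1 ≤ m → 2 ≤ n →
    (n ≡ 2 → IndependenceNumber (F2 (EK n m)) ⌈ (m + 2) /2⌉) ×
    (3 ≤ n → IndependenceNumber (F2 (EK n m)) (⌊ m /2⌋ + n C 2))
theorem7 zero    _ () _
-- 2 ≤ n is implied by the hypothesis of either case.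
theorem7 (suc m) n _ _ = (λ { refl → α-n≡2 m }) , α-n≥3
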